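{- Let $k\in\mathbb{Z}^+$, let $\alpha,\beta,\delta\in\mathbb{Z}$ with $\delta>0$ and $2^k\cdot\alpha\%\delta>0$, and let $f(r)=(\alpha\cdot r+\beta)/\delta$ for $r\in\mathbb{Z}$. Set $\alpha'=2^k\cdot\alpha/\delta$, $\varepsilon=2^k\cdot\alpha\%\delta$ and $\beta'=\min\{2^k-1-(\alpha'\cdot r-2^k\cdot f(r))\,;\,r\in[0,\delta[\}$. For $r\in[0,\delta[$ define $q(r)=\min\{p\in\mathbb{Z}^+\,;\,-\varepsilon\cdot p+\alpha'\cdot r+\beta'-2^k\cdot f(r)<0\}$ and $M(r)=\delta\cdot q(r)+r$, and let $N=\min\{M(r)\,;\,r\in[0,\delta[\}$. Then $(\alpha\cdot r+\beta)/\delta=(\alpha'\cdot r+\beta')/2^k$ for all $r\in[0,N[$.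
   Context: For $n,\delta\in\mathbb{Z}$ with $\delta\neq0$, $n/\delta$ and $n\%\delta$ denote the quotient and remainder of Euclidean division: the unique integers $q,s$ with $n=q\cdot\delta+s$ and $0\le s<|\delta|$. The operators $\cdot$, $/$, $\%$ have equal precedence and associate left to right. $\mathbb{Z}^+=\{x\in\mathbb{Z}: x\ge0\}$. For integers $a,b$, $[a,b[$ denotes $\{r\in\mathbb{Z}: a\le r<b\}$. -}

module Defs where

open import Data.Nat as ℕ using (ℕ)
open import Data.Nat.Properties using (m^n≢0)
open import Data.Integer using (ℤ; +_; _≤_; _<_; _/_; _*_)
open import Data.Product using (Σ; _×_; ∃)
open import Relation.Binary.PropositionalEquality using (_≡_)

two^ : ℕ → ℤ
two^ k = + (2 ℕ.^ k)

-- Euclidean quotient n / 2^k (stdlib's Data.Integer._/_ is Euclidean division: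
-- remainder in [0, |divisor|[)
_/2^_ : ℤ → ℕ → ℤ
n /2^ k = _/_ n (two^ k) {{m^n≢0 2 k}}

_∈[_,_[ : ℤ → ℤ → ℤ → Set
r ∈[ a , b [ = (a ≤ r) × (r < b)

IsMinOver : ℤ → ℤ → (ℤ → ℤ) → ℤ → Set
IsMinOver a b g m =
  (Σ ℤ (λ r → (r ∈[ a , b [) × (m ≡ g r))) × (∀ r → r ∈[ a , b [ → m ≤ g r)

IsLeastNat : (ℕ → Set) → ℕ → Set
IsLeastNat P p = P p × (∀ p' → P p' → p ℕ.≤ p')

{-# OPTIONS --safe #-}
module Submission where

open import Defs
open import Data.Nat as ℕ using (ℕ)
open import Data.Nat.Properties using (m^n≢0)
open import Data.Integer using (ℤ; +_; -_; _+_; _-_; _*_; _/_; _%_; _≤_; _<_; NonZero)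
open import Data.Integer.Base using (+≤+; +<+; ∣_∣; NonNegative; pred) renaming (suc to sucℤ)
open import Data.Integer.Properties
open import Data.Integer.DivMod using (a≡a%n+[a/n]*n; n%d<d; 0≤n⇒0≤n/d)
open import Data.Integer.Tactic.RingSolver using (solve-∀)
open import Data.Product using (_,_; proj₂)
open import Relation.Binary.PropositionalEquality

-- Write r = s + t δ with s ∈ [0, δ[ and t ≥ 0. Then f r = f s + α t, and since 2^k α = ε + α′ δ the
-- error E r = α′ r + β′ − 2^k f r equals E s − ε t. The choice of β′ gives E s ≤ 2^k − 1, so E r < 2^k;
-- and E r < 0 would make t a candidate in the definition of q s, so N ≤ M s ≤ δ t + s = r.
-- Hence 0 ≤ E r < 2^k, which says exactly that f r is the quotient of α′ r + β′ by 2^k.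

x+q*d≡y+p*d⇒q≤p : ∀ {d x y q p} .{{_ : NonNegative d}} → + 0 ≤ x → y < d →
                  x + q * d ≡ y + p * d → q ≤ p
x+q*d≡y+p*d⇒q≤p {d} {x} {y} {q} {p} 0≤x y<d eq =
  ≮⇒≥ λ p<q → <-irrefl refl (y+p*d<y+p*d p<q)
  where
  y+p*d<y+p*d : p < q → y + p * d < y + p * d
  y+p*d<y+p*d p<q = begin-strict
    y + p * d    <⟨ +-monoˡ-< (p * d) y<d ⟩
    d + p * d    ≡⟨ suc-* p d ⟨
    sucℤ p * d   ≤⟨ *-monoʳ-≤-nonNeg d (i<j⇒suc[i]≤j p<q) ⟩
    q * d        ≡⟨ +-identityˡ (q * d) ⟨
    + 0 + q * d  ≤⟨ +-monoˡ-≤ (q * d) 0≤x ⟩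
    x + q * d    ≡⟨ eq ⟩
    y + p * d    ∎
    where open ≤-Reasoning

[x+q*d]/d≡q : ∀ m .{{_ : ℕ.NonZero m}} {x} q → + 0 ≤ x → x < + m → (x + q * + m) / + m ≡ q
[x+q*d]/d≡q m {x} q 0≤x x<m = ≤-antisym
  (x+q*d≡y+p*d⇒q≤p (+≤+ ℕ.z≤n) x<m (sym euclid))
  (x+q*d≡y+p*d⇒q≤p 0≤x (+<+ (n%d<d n (+ m))) euclid)
  where
  n : ℤ
  n = x + q * + m
  euclid : n ≡ + (n % + m) + (n / + m) * + m
  euclid = a≡a%n+[a/n]*n n (+ m)

[n+t*d]/d≡n/d+t : ∀ m .{{_ : ℕ.NonZero m}} n t → (n + t * + m) / + m ≡ n / + m + t
[n+t*d]/d≡n/d+t m n t = begin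
  (n + t * + m) / + m
    ≡⟨ cong (λ n′ → (n′ + t * + m) / + m) (a≡a%n+[a/n]*n n (+ m)) ⟩
  (+ (n % + m) + n / + m * + m + t * + m) / + m
    ≡⟨ cong (_/ + m) (regroup (+ (n % + m)) (n / + m) t (+ m)) ⟩
  (+ (n % + m) + (n / + m + t) * + m) / + m
    ≡⟨ [x+q*d]/d≡q m (n / + m + t) (+≤+ ℕ.z≤n) (+<+ (n%d<d n (+ m))) ⟩
  n / + m + t
    ∎
  where
  open ≡-Reasoning
  regroup : ∀ x q t d → x + q * d + t * d ≡ x + (q + t) * d
  regroup = solve-∀

0≤n⇒n≡n%d+∣n/d∣*d : ∀ m .{{_ : ℕ.NonZero m}} {n} → + 0 ≤ n →
                    n ≡ + (n % + m) + + ∣ n / + m ∣ * + m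
0≤n⇒n≡n%d+∣n/d∣*d m {n} 0≤n = begin
  n                                  ≡⟨ a≡a%n+[a/n]*n n (+ m) ⟩
  + (n % + m) + n / + m * + m        ≡⟨ cong (λ t → + (n % + m) + t * + m) +∣n/d∣≡n/d ⟨
  + (n % + m) + + ∣ n / + m ∣ * + m  ∎
  where
  open ≡-Reasoning
  +∣n/d∣≡n/d : + ∣ n / + m ∣ ≡ n / + m
  +∣n/d∣≡n/d = 0≤i⇒+∣i∣≡i (0≤n⇒0≤n/d n (+ m) 0≤n (+≤+ ℕ.z≤n))

module AffineFloor (k : ℕ) (α β : ℤ) (m : ℕ) .{{_ : ℕ.NonZero m}} where

  δ K : ℤ
  δ = + m
  K = two^ k

  f : ℤ → ℤ
  f r = (α * r + β) / δ

  α′ : ℤ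
  α′ = (K * α) / δ

  ε : ℕ
  ε = (K * α) % δ

  error : ℤ → ℤ → ℤ
  error β′ r = α′ * r + β′ - K * f r

  f-shift : ∀ s t → f (s + t * δ) ≡ f s + α * t
  f-shift s t = begin
    (α * (s + t * δ) + β) / δ      ≡⟨ cong (_/ δ) (distribute α s t δ β) ⟩
    (α * s + β + α * t * δ) / δ    ≡⟨ [n+t*d]/d≡n/d+t m (α * s + β) (α * t) ⟩
    f s + α * t                    ∎
    where
    open ≡-Reasoning
    distribute : ∀ α s t δ β → α * (s + t * δ) + β ≡ α * s + β + α * t * δ
    distribute = solve-∀

  error-shift : ∀ β′ s t → error β′ (s + t * δ) ≡ - + ε * t + α′ * s + β′ - K * f s
  error-shift β′ s t = begin
    α′ * (s + t * δ) + β′ - K * f (s + t * δ)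
      ≡⟨ cong (λ y → α′ * (s + t * δ) + β′ - K * y) (f-shift s t) ⟩
    α′ * (s + t * δ) + β′ - K * (f s + α * t)
      ≡⟨ expand α′ s t δ β′ K (f s) α ⟩
    - (K * α - α′ * δ) * t + α′ * s + β′ - K * f s
      ≡⟨ cong (λ c → - c * t + α′ * s + β′ - K * f s) Kα-α′δ≡ε ⟩
    - + ε * t + α′ * s + β′ - K * f s
      ∎
    where
    open ≡-Reasoning
    expand : ∀ a s t δ b K g α →
             a * (s + t * δ) + b - K * (g + α * t) ≡ - (K * α - a * δ) * t + a * s + b - K * g
    expand = solve-∀
    cancel : ∀ e a → e + a - a ≡ e
    cancel = solve-∀
    Kα-α′δ≡ε : K * α - α′ * δ ≡ + ε
    Kα-α′δ≡ε = trans (cong (_- α′ * δ) (a≡a%n+[a/n]*n (K * α) δ)) (cancel (+ ε) (α′ * δ))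

  error<K : ∀ β′ s t → β′ ≤ K - + 1 - (α′ * s - K * f s) →
            - + ε * + t + α′ * s + β′ - K * f s < K
  error<K β′ s t β′≤ = i≤pred[j]⇒i<j (begin
    - + ε * + t + α′ * s + β′ - K * f s
      ≡⟨ reorder (+ ε) (+ t) (α′ * s) β′ (K * f s) ⟩
    α′ * s + β′ - K * f s - + ε * + t
      ≤⟨ i-j≤i _ (+ ε * + t) {{εt-nonNegative}} ⟩
    α′ * s + β′ - K * f s
      ≤⟨ +-monoˡ-≤ (- (K * f s)) (+-monoʳ-≤ (α′ * s) β′≤) ⟩
    α′ * s + (K - + 1 - (α′ * s - K * f s)) - K * f s
      ≡⟨ collapse (α′ * s) K (K * f s) ⟩
    pred K
      ∎)
    where
    open ≤-Reasoning
    εt-nonNegative : NonNegative (+ ε * + t)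
    εt-nonNegative = subst NonNegative (pos-* ε t) _
    reorder : ∀ e t a b d → - e * t + a + b - d ≡ a + b - d - e * t
    reorder = solve-∀
    collapse : ∀ a K d → a + (K - + 1 - (a - d)) - d ≡ - + 1 + K
    collapse = solve-∀

  f≡[α′r+β′]/2^k : ∀ β′ r → + 0 ≤ error β′ r → error β′ r < K → f r ≡ (α′ * r + β′) /2^ k
  f≡[α′r+β′]/2^k β′ r 0≤e e<K = sym (begin
    (α′ * r + β′) /2^ k               ≡⟨ cong (_/2^ k) (split (α′ * r) β′ K (f r)) ⟩
    (error β′ r + f r * K) /2^ k      ≡⟨ [x+q*d]/d≡q (2 ℕ.^ k) {{m^n≢0 2 k}} (f r) 0≤e e<K ⟩
    f r                               ∎)
    where
    open ≡-Reasoning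
    split : ∀ a b K q → a + b ≡ a + b - K * q + q * K
    split = solve-∀

theorem3 : (k : ℕ) (α β δ : ℤ) .{{_ : NonZero δ}} →
    + 0 < δ → 0 ℕ.< (two^ k * α) % δ →
    let f : ℤ → ℤ
        f r = (α * r + β) / δ
        α' = (two^ k * α) / δ
        ε = + ((two^ k * α) % δ)
    in (β' : ℤ) →
    IsMinOver (+ 0) δ (λ r → two^ k - + 1 - (α' * r - two^ k * f r)) β' →
    (q : ℤ → ℕ) →
    (∀ r → r ∈[ + 0 , δ [ →
      IsLeastNat (λ p → - ε * + p + α' * r + β' - two^ k * f r < + 0) (q r)) →
    (N : ℤ) →
    IsMinOver (+ 0) δ (λ r → δ * + (q r) + r) N →
    ∀ r → r ∈[ + 0 , N [ → (α * r + β) / δ ≡ (α' * r + β') /2^ k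
-- The hypothesis ε > 0 only guarantees that q exists; here q is given.
theorem3 k α β (+ m) _ _ β′ (_ , β′-least) q q-least N (_ , N-least) r (0≤r , r<N) =
  f≡[α′r+β′]/2^k β′ r 0≤error error<2^k
  where
  open AffineFloor k α β m
  s : ℤ
  s = + (r % δ)
  t : ℕ
  t = ∣ r / δ ∣
  s∈[0,δ[ : s ∈[ + 0 , δ [
  s∈[0,δ[ = +≤+ ℕ.z≤n , +<+ (n%d<d r δ)
  r≡s+t*δ : r ≡ s + + t * δ
  r≡s+t*δ = 0≤n⇒n≡n%d+∣n/d∣*d m 0≤r
  error-r : error β′ r ≡ - + ε * + t + α′ * s + β′ - K * f s
  error-r = trans (cong (error β′) r≡s+t*δ) (error-shift β′ s (+ t))
  q[s]≤t⇒N≤r : q s ℕ.≤ t → N ≤ r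
  q[s]≤t⇒N≤r q≤t = begin
    N                  ≤⟨ N-least s s∈[0,δ[ ⟩
    δ * + q s + s      ≤⟨ +-monoˡ-≤ s (*-monoˡ-≤-nonNeg δ (+≤+ q≤t)) ⟩
    δ * + t + s        ≡⟨ trans (+-comm (δ * + t) s) (cong (_+_ s) (*-comm δ (+ t))) ⟩
    s + + t * δ        ≡⟨ r≡s+t*δ ⟨
    r                  ∎
    where open ≤-Reasoning
  0≤error : + 0 ≤ error β′ r
  0≤error = ≮⇒≥ λ error<0 → <⇒≱ r<N (q[s]≤t⇒N≤r
    (proj₂ (q-least s s∈[0,δ[) t (subst (_< + 0) error-r error<0)))
  error<2^k : error β′ r < K
  error<2^k = subst (_< K) (sym error-r) (error<K β′ s t (β′-least s s∈[0,δ[))
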